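{- Let $G$ be an $\ell$-partite graph with parts $V_1,\ldots,V_\ell$, each of size exactly $n\ge 1$, such that $d(V_i,V_j)=\frac{\|G[V_i\cup V_j]\|}{n^2}\ge\frac12$ for all $i\ne j$, and suppose $G$ contains no triangle. Then every independent set $X\subseteq V(G)$ satisfies $|X|\le\frac{(\ell+1)n}{2}$.
   Context: All graphs are simple and finite; $\|H\|$ is the number of edges of $H$. -}

module Defs where

open import Data.Nat using (ℕ; zero; suc; _+_; _*_; _<ᵇ_)
open import Data.Bool using (Bool; true; false; if_then_else_)
open import Data.Fin using (Fin; toℕ)
open import Data.List using (List; map; allFin)
open import Data.Nat.ListAction using (sum)
open import Data.Product using (_×_; _,_)
open import Relation.Binary.PropositionalEquality using (_≡_; _≢_)
open import Relation.Nullary using (¬_)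

Σᶠ : (n : ℕ) → (Fin n → ℕ) → ℕ
Σᶠ n f = sum (map f (allFin n))

⟦_⟧ : Bool → ℕ
⟦ true ⟧ = 1
⟦ false ⟧ = 0

-- Vertex set of an ℓ-partite graph with parts V_1..V_ℓ each of size n:
-- vertex (i , a) is the a-th vertex of part V_i.
Vtx : ℕ → ℕ → Set
Vtx ℓ n = Fin ℓ × Fin n

record SimpleGraph (V : Set) : Set where
  field
    adj   : V → V → Bool
    sym   : ∀ u v → adj u v ≡ adj v u
    irrefl : ∀ v → adj v v ≡ false
open SimpleGraph public

module _ {ℓ n : ℕ} (G : SimpleGraph (Vtx ℓ n)) where

  IsPartite : Set
  IsPartite = ∀ i a b → adj G (i , a) (i , b) ≡ false

  edgesIn : Fin ℓ → ℕ
  edgesIn i = Σᶠ n λ a → Σᶠ n λ b →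
    if toℕ a <ᵇ toℕ b then ⟦ adj G (i , a) (i , b) ⟧ else 0

  edgesBetween : Fin ℓ → Fin ℓ → ℕ
  edgesBetween i j = Σᶠ n λ a → Σᶠ n λ b → ⟦ adj G (i , a) (j , b) ⟧

  edgesInduced : Fin ℓ → Fin ℓ → ℕ
  edgesInduced i j = edgesIn i + edgesIn j + edgesBetween i j

  TriangleFree : Set
  TriangleFree = ∀ u v w → ¬ (adj G u v ≡ true × adj G v w ≡ true × adj G u w ≡ true)

  Independent : (Vtx ℓ n → Bool) → Set
  Independent X = ∀ u v → X u ≡ true → X v ≡ true → adj G u v ≡ false

card : {ℓ n : ℕ} → (Vtx ℓ n → Bool) → ℕ
card {ℓ} {n} X = Σᶠ ℓ λ i → Σᶠ n λ a → ⟦ X (i , a) ⟧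

-- Induction on the number of parts.  The neighbourhood of a vertex is independent
-- (no triangles) and meets only the other ℓ − 1 parts, so by induction every
-- degree is at most ℓn/2.  Each edge has an endpoint outside the independent set X,
-- hence 2‖G‖ ≤ 2 · (ℓn/2) · |V ∖ X|, while density gives 2‖G‖ ≥ ℓ(ℓ − 1)n²/2.
-- Thus |V ∖ X| ≥ (ℓ − 1)n/2 and |X| = ℓn − |V ∖ X| ≤ (ℓ + 1)n/2.
module Submission where

open import Data.Nat.Properties
open import Algebra.Properties.CommutativeSemigroup *-commutativeSemigroup using (x∙yz≈y∙xz)
open import Algebra.Properties.Semiring.Sum +-*-semiring
  using (sum; sum-syntax; sum-cong-≗; sum-remove; ∑-distrib-+; ∑-comm; *-distribˡ-sum; *-distribʳ-sum)
open import Data.Bool using (Bool; true; false; not; if_then_else_)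
open import Data.Empty using (⊥-elim)
open import Data.Fin using (Fin; zero; suc; punchIn; toℕ)
open import Data.Fin.Properties using (punchIn-injective; punchInᵢ≢i)
open import Data.List using (map; tabulate)
open import Data.Nat using (ℕ; zero; suc; _+_; _*_; _≤_; _<ᵇ_; z≤n; s≤s; NonZero; >-nonZero)
import Data.Nat.ListAction as List
open import Data.Nat.Solver using (module +-*-Solver)
open import Data.Product using (_,_; map₁)
open import Defs hiding (sym)
open import Function using (_∘_; Injective)
open import Relation.Binary.PropositionalEquality
  using (_≡_; _≢_; _≗_; refl; sym; trans; cong; subst; subst₂; module ≡-Reasoning)
open import Relation.Nullary using (contradiction)
open +-*-Solver using (solve; _:=_; _:+_; _:*_; con)

sum-tabulate : ∀ m {k} (f : Fin k → ℕ) (g : Fin m → Fin k) →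
               List.sum (map f (tabulate g)) ≡ ∑[ i < m ] f (g i)
sum-tabulate zero    f g = refl
sum-tabulate (suc m) f g = cong (f (g zero) +_) (sum-tabulate m f (g ∘ suc))

Σᶠ≡∑ : ∀ n (f : Fin n → ℕ) → Σᶠ n f ≡ ∑[ i < n ] f i
Σᶠ≡∑ n f = sum-tabulate n f (λ i → i)

sum-mono-≤ : ∀ {n} {f g : Fin n → ℕ} → (∀ i → f i ≤ g i) → sum f ≤ sum g
sum-mono-≤ {zero}  f≤g = z≤n
sum-mono-≤ {suc n} f≤g = +-mono-≤ (f≤g zero) (sum-mono-≤ (f≤g ∘ suc))

sum-const : ∀ n c → ∑[ i < n ] c ≡ n * c
sum-const zero    c = refl
sum-const (suc n) c = cong (c +_) (sum-const n c)

sum-zero : ∀ n {f : Fin n → ℕ} → (∀ i → f i ≡ 0) → sum f ≡ 0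
sum-zero n f≡0 = trans (sum-cong-≗ f≡0) (trans (sum-const n 0) (*-zeroʳ n))

Σᶠ-zero : ∀ {k} {f : Fin k → ℕ} → (∀ x → f x ≡ 0) → Σᶠ k f ≡ 0
Σᶠ-zero {k} {f} f≡0 = trans (Σᶠ≡∑ k f) (sum-zero k f≡0)

sum-≥-except : ∀ m (i : Fin (suc m)) c (f : Fin (suc m) → ℕ) →
        (∀ j → j ≢ i → c ≤ f j) → m * c ≤ sum f
sum-≥-except m i c f c≤f = begin
  m * c                             ≡⟨ sum-const m c ⟨
  ∑[ j < m ] c                      ≤⟨ sum-mono-≤ (λ j → c≤f (punchIn i j) (punchInᵢ≢i i j)) ⟩
  ∑[ j < m ] f (punchIn i j)        ≤⟨ m≤n+m _ (f i) ⟩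
  f i + ∑[ j < m ] f (punchIn i j)  ≡⟨ sum-remove {i = i} f ⟨
  sum f                             ∎
  where open ≤-Reasoning

module _ {ℓ n : ℕ} where

  ∑ᵥ : (Vtx ℓ n → ℕ) → ℕ
  ∑ᵥ f = ∑[ i < ℓ ] ∑[ a < n ] f (i , a)

  ∑ᵥ-cong : {f g : Vtx ℓ n → ℕ} → f ≗ g → ∑ᵥ f ≡ ∑ᵥ g
  ∑ᵥ-cong f≗g = sum-cong-≗ λ i → sum-cong-≗ λ a → f≗g (i , a)

  ∑ᵥ-mono-≤ : {f g : Vtx ℓ n → ℕ} → (∀ v → f v ≤ g v) → ∑ᵥ f ≤ ∑ᵥ g
  ∑ᵥ-mono-≤ f≤g = sum-mono-≤ λ i → sum-mono-≤ λ a → f≤g (i , a)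

  ∑ᵥ-distrib-+ : ∀ (f g : Vtx ℓ n → ℕ) → ∑ᵥ (λ v → f v + g v) ≡ ∑ᵥ f + ∑ᵥ g
  ∑ᵥ-distrib-+ f g = trans (sum-cong-≗ λ i → ∑-distrib-+ (λ a → f (i , a)) (λ a → g (i , a)))
    (∑-distrib-+ (λ i → ∑[ a < n ] f (i , a)) (λ i → ∑[ a < n ] g (i , a)))

  *-distribˡ-∑ᵥ : ∀ c (f : Vtx ℓ n → ℕ) → c * ∑ᵥ f ≡ ∑ᵥ (λ v → c * f v)
  *-distribˡ-∑ᵥ c f = trans (*-distribˡ-sum c (λ i → ∑[ a < n ] f (i , a)))
    (sum-cong-≗ λ i → *-distribˡ-sum c (λ a → f (i , a)))

  *-distribʳ-∑ᵥ : ∀ c (f : Vtx ℓ n → ℕ) → ∑ᵥ f * c ≡ ∑ᵥ (λ v → f v * c)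
  *-distribʳ-∑ᵥ c f = trans (*-distribʳ-sum c (λ i → ∑[ a < n ] f (i , a)))
    (sum-cong-≗ λ i → *-distribʳ-sum c (λ a → f (i , a)))

  ∑ᵥ-comm : ∀ (f : Vtx ℓ n → Vtx ℓ n → ℕ) →
            ∑ᵥ (λ u → ∑ᵥ (λ w → f u w)) ≡ ∑ᵥ (λ w → ∑ᵥ (λ u → f u w))
  ∑ᵥ-comm f = begin
    ∑[ i < ℓ ] ∑[ a < n ] ∑[ j < ℓ ] ∑[ b < n ] f (i , a) (j , b) ≡⟨ sum-cong-≗ {ℓ} (λ i → ∑-comm {n} {ℓ} _) ⟩
    ∑[ i < ℓ ] ∑[ j < ℓ ] ∑[ a < n ] ∑[ b < n ] f (i , a) (j , b) ≡⟨ ∑-comm {ℓ} {ℓ} _ ⟩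
    ∑[ j < ℓ ] ∑[ i < ℓ ] ∑[ a < n ] ∑[ b < n ] f (i , a) (j , b) ≡⟨ sum-cong-≗ {ℓ} (λ j → sum-cong-≗ {ℓ} λ i → ∑-comm {n} {n} _) ⟩
    ∑[ j < ℓ ] ∑[ i < ℓ ] ∑[ b < n ] ∑[ a < n ] f (i , a) (j , b) ≡⟨ sum-cong-≗ {ℓ} (λ j → ∑-comm {ℓ} {n} _) ⟩
    ∑[ j < ℓ ] ∑[ b < n ] ∑[ i < ℓ ] ∑[ a < n ] f (i , a) (j , b) ∎
    where open ≡-Reasoning

∑ᵥ-const : ∀ ℓ n c → ∑ᵥ {ℓ} {n} (λ _ → c) ≡ ℓ * n * c
∑ᵥ-const ℓ n c = begin
  ∑[ i < ℓ ] ∑[ a < n ] c ≡⟨ sum-cong-≗ {ℓ} (λ _ → sum-const n c) ⟩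
  ∑[ i < ℓ ] (n * c)      ≡⟨ sum-const ℓ (n * c) ⟩
  ℓ * (n * c)             ≡⟨ *-assoc ℓ n c ⟨
  ℓ * n * c               ∎
  where open ≡-Reasoning

size : {ℓ n : ℕ} → (Vtx ℓ n → Bool) → ℕ
size X = ∑ᵥ λ v → ⟦ X v ⟧

outside : {ℓ n : ℕ} → (Vtx ℓ n → Bool) → ℕ
outside X = ∑ᵥ λ v → ⟦ not (X v) ⟧

card≡size : {ℓ n : ℕ} (X : Vtx ℓ n → Bool) → card X ≡ size X
card≡size {ℓ} {n} X = trans (Σᶠ≡∑ ℓ _) (sum-cong-≗ {ℓ} λ i → Σᶠ≡∑ n _)

size+outside : {ℓ n : ℕ} (X : Vtx ℓ n → Bool) → size X + outside X ≡ ℓ * n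
size+outside {ℓ} {n} X = begin
  size X + outside X                      ≡⟨ ∑ᵥ-distrib-+ (λ v → ⟦ X v ⟧) (λ v → ⟦ not (X v) ⟧) ⟨
  ∑ᵥ (λ v → ⟦ X v ⟧ + ⟦ not (X v) ⟧)      ≡⟨ ∑ᵥ-cong (λ v → ⟦b⟧+⟦not-b⟧ (X v)) ⟩
  ∑ᵥ {ℓ} {n} (λ _ → 1)                    ≡⟨ ∑ᵥ-const ℓ n 1 ⟩
  ℓ * n * 1                               ≡⟨ *-identityʳ (ℓ * n) ⟩
  ℓ * n                                   ∎
  where
  open ≡-Reasoning
  ⟦b⟧+⟦not-b⟧ : ∀ b → ⟦ b ⟧ + ⟦ not b ⟧ ≡ 1
  ⟦b⟧+⟦not-b⟧ true  = refl
  ⟦b⟧+⟦not-b⟧ false = refl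

module _ {ℓ n : ℕ} (G : SimpleGraph (Vtx ℓ n)) where

  degree : Vtx ℓ n → ℕ
  degree v = ∑ᵥ λ w → ⟦ adj G v w ⟧

  between : Fin ℓ → Fin ℓ → ℕ
  between i j = ∑[ a < n ] ∑[ b < n ] ⟦ adj G (i , a) (j , b) ⟧

  HalfDense : Set
  HalfDense = ∀ i j → i ≢ j → n * n ≤ 2 * between i j

  edgesIn-partite : IsPartite G → ∀ i → edgesIn G i ≡ 0
  edgesIn-partite part i = Σᶠ-zero λ a → Σᶠ-zero λ b → no-edge a b
    where
    no-edge : ∀ a b → (if toℕ a <ᵇ toℕ b then ⟦ adj G (i , a) (i , b) ⟧ else 0) ≡ 0
    no-edge a b rewrite part i a b with toℕ a <ᵇ toℕ b
    ... | true  = refl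
    ... | false = refl

  edgesInduced-partite : IsPartite G → ∀ i j → edgesInduced G i j ≡ between i j
  edgesInduced-partite part i j
    rewrite edgesIn-partite part i | edgesIn-partite part j =
    trans (Σᶠ≡∑ n _) (sum-cong-≗ {n} λ a → Σᶠ≡∑ n _)

  neighbourhood-independent : TriangleFree G → ∀ u → Independent G (adj G u)
  neighbourhood-independent tri u v w uv uw with adj G v w in vw
  ... | true  = ⊥-elim (tri u v w (uv , vw , uw))
  ... | false = refl

  ∑-degree≡∑-between : ∑ᵥ degree ≡ ∑[ i < ℓ ] ∑[ j < ℓ ] between i j
  ∑-degree≡∑-between = sum-cong-≗ {ℓ} λ i → ∑-comm {n} {ℓ} _

  ∑-degree-≤-outside-degrees : ∀ (X : Vtx ℓ n → Bool) → Independent G X →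
    ∑ᵥ degree ≤ 2 * ∑ᵥ (λ v → ⟦ not (X v) ⟧ * degree v)
  ∑-degree-≤-outside-degrees X indep = begin
    ∑ᵥ (λ u → ∑ᵥ λ v → A u v)
      ≤⟨ ∑ᵥ-mono-≤ (λ u → ∑ᵥ-mono-≤ λ v → edge-meets-complement u v) ⟩
    ∑ᵥ (λ u → ∑ᵥ λ v → w u * A u v + w v * A u v)
      ≡⟨ trans (∑ᵥ-cong λ u → ∑ᵥ-distrib-+ (λ v → w u * A u v) (λ v → w v * A u v))
               (∑ᵥ-distrib-+ (λ u → ∑ᵥ λ v → w u * A u v) (λ u → ∑ᵥ λ v → w v * A u v)) ⟩
    T + ∑ᵥ (λ u → ∑ᵥ λ v → w v * A u v)
      ≡⟨ cong (T +_) (trans (∑ᵥ-comm (λ u v → w v * A u v))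
                      (∑ᵥ-cong λ v → ∑ᵥ-cong λ u → cong (λ b → w v * ⟦ b ⟧) (SimpleGraph.sym G u v))) ⟩
    T + T
      ≡⟨ cong (T +_) (+-identityʳ T) ⟨
    2 * T
      ≡⟨ cong (2 *_) (∑ᵥ-cong λ u → *-distribˡ-∑ᵥ (w u) (A u)) ⟨
    2 * ∑ᵥ (λ v → w v * degree v) ∎
    where
    open ≤-Reasoning
    A : Vtx ℓ n → Vtx ℓ n → ℕ
    A u v = ⟦ adj G u v ⟧
    w : Vtx ℓ n → ℕ
    w v = ⟦ not (X v) ⟧
    T : ℕ
    T = ∑ᵥ λ u → ∑ᵥ λ v → w u * A u v
    edge-meets-complement : ∀ u v → A u v ≤ w u * A u v + w v * A u v
    edge-meets-complement u v with X u in Xu | X v in Xv | adj G u v in uv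
    ... | true  | true  | true  = contradiction (trans (sym uv) (indep u v Xu Xv)) λ ()
    ... | false | _     | true  = s≤s z≤n
    ... | true  | false | true  = ≤-refl
    ... | _     | _     | false = z≤n

  weighted-∑-degree-≤ : ∀ (w : Vtx ℓ n → ℕ) {D} → (∀ v → 2 * degree v ≤ D) →
    2 * ∑ᵥ (λ v → w v * degree v) ≤ ∑ᵥ w * D
  weighted-∑-degree-≤ w {D} 2deg≤D = begin
    2 * ∑ᵥ (λ v → w v * degree v)       ≡⟨ *-distribˡ-∑ᵥ 2 (λ v → w v * degree v) ⟩
    ∑ᵥ (λ v → 2 * (w v * degree v))     ≡⟨ ∑ᵥ-cong (λ v → x∙yz≈y∙xz 2 (w v) (degree v)) ⟩
    ∑ᵥ (λ v → w v * (2 * degree v))     ≤⟨ ∑ᵥ-mono-≤ (λ v → *-monoʳ-≤ (w v) (2deg≤D v)) ⟩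
    ∑ᵥ (λ v → w v * D)                  ≡⟨ *-distribʳ-∑ᵥ D w ⟨
    ∑ᵥ w * D                            ∎
    where open ≤-Reasoning

∑-degree-≥-half-dense : ∀ {m n} (G : SimpleGraph (Vtx (suc m) n)) → HalfDense G →
  suc m * (m * (n * n)) ≤ 2 * ∑ᵥ (degree G)
∑-degree-≥-half-dense {m} {n} G dense = begin
  suc m * (m * (n * n))                               ≡⟨ sum-const (suc m) _ ⟨
  ∑[ i < suc m ] (m * (n * n))                        ≤⟨ sum-mono-≤ (λ i → sum-≥-except m i (n * n) _
                                                           λ j j≢i → dense i j (j≢i ∘ sym)) ⟩
  ∑[ i < suc m ] ∑[ j < suc m ] (2 * between G i j)   ≡⟨ sum-cong-≗ {suc m} (λ i → *-distribˡ-sum 2 (between G i)) ⟨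
  ∑[ i < suc m ] (2 * ∑[ j < suc m ] between G i j)   ≡⟨ *-distribˡ-sum 2 (λ i → ∑[ j < suc m ] between G i j) ⟨
  2 * ∑[ i < suc m ] ∑[ j < suc m ] between G i j     ≡⟨ cong (2 *_) (∑-degree≡∑-between G) ⟨
  2 * ∑ᵥ (degree G)                                   ∎
  where open ≤-Reasoning

outside-≥-half-dense : ∀ {m n} .{{_ : NonZero n}} (G : SimpleGraph (Vtx (suc m) n)) →
  HalfDense G → (∀ v → 2 * degree G v ≤ suc m * n) →
  ∀ X → Independent G X → m * n ≤ 2 * outside X
outside-≥-half-dense {m} {n} G dense 2deg≤ X indep = *-cancelˡ-≤ (suc m * n) {{m*n≢0 (suc m) n}} (begin
  suc m * n * (m * n)                               ≡⟨ solve 2 (λ m n → (con 1 :+ m) :* n :* (m :* n)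
                                                                   := (con 1 :+ m) :* (m :* (n :* n))) refl m n ⟩
  suc m * (m * (n * n))                             ≤⟨ ∑-degree-≥-half-dense G dense ⟩
  2 * ∑ᵥ (degree G)                                 ≤⟨ *-monoʳ-≤ 2 (∑-degree-≤-outside-degrees G X indep) ⟩
  2 * (2 * ∑ᵥ (λ v → ⟦ not (X v) ⟧ * degree G v))  ≤⟨ *-monoʳ-≤ 2 (weighted-∑-degree-≤ G (λ v → ⟦ not (X v) ⟧) 2deg≤) ⟩
  2 * (outside X * (suc m * n))                     ≡⟨ solve 3 (λ m n t → con 2 :* (t :* ((con 1 :+ m) :* n))
                                                                   := (con 1 :+ m) :* n :* (con 2 :* t)) refl m n (outside X) ⟩
  suc m * n * (2 * outside X)                       ∎)
  where open ≤-Reasoning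

restrict : ∀ {m ℓ n} → (Fin m → Fin ℓ) → SimpleGraph (Vtx ℓ n) → SimpleGraph (Vtx m n)
restrict f G = record
  { adj    = λ u v → adj G (map₁ f u) (map₁ f v)
  ; sym    = λ u v → SimpleGraph.sym G (map₁ f u) (map₁ f v)
  ; irrefl = λ v → irrefl G (map₁ f v)
  }

module _ {m ℓ n : ℕ} (f : Fin m → Fin ℓ) (G : SimpleGraph (Vtx ℓ n)) where

  restrict-partite : IsPartite G → IsPartite (restrict f G)
  restrict-partite part i = part (f i)

  restrict-half-dense : Injective _≡_ _≡_ f → HalfDense G → HalfDense (restrict f G)
  restrict-half-dense inj dense i j i≢j = dense (f i) (f j) (i≢j ∘ inj)

  restrict-triangle-free : TriangleFree G → TriangleFree (restrict f G)
  restrict-triangle-free tri u v w = tri (map₁ f u) (map₁ f v) (map₁ f w)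

  restrict-independent : ∀ {X} → Independent G X → Independent (restrict f G) (X ∘ map₁ f)
  restrict-independent indep u v = indep (map₁ f u) (map₁ f v)

degree≡neighbours-outside-part : ∀ {m n} (G : SimpleGraph (Vtx (suc m) n)) → IsPartite G →
  ∀ k a → degree G (k , a) ≡ size (adj G (k , a) ∘ map₁ (punchIn k))
degree≡neighbours-outside-part {m} {n} G part k a = begin
  sum row         ≡⟨ sum-remove {i = k} row ⟩
  row k + size N  ≡⟨ cong (_+ size N) (sum-zero n λ b → cong ⟦_⟧ (part k a b)) ⟩
  size N          ∎
  where
  open ≡-Reasoning
  row : Fin (suc m) → ℕ
  row j = ∑[ b < n ] ⟦ adj G (k , a) (j , b) ⟧
  N : Vtx m n → Bool
  N = adj G (k , a) ∘ map₁ (punchIn k)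

independent-set-bound : ∀ ℓ {n} .{{_ : NonZero n}} (G : SimpleGraph (Vtx ℓ n)) →
  IsPartite G → HalfDense G → TriangleFree G →
  ∀ X → Independent G X → 2 * size X ≤ suc ℓ * n
independent-set-bound zero    G part dense tri X indep = z≤n
independent-set-bound (suc m) {n} G part dense tri X indep = +-cancelʳ-≤ (m * n) _ _ (begin
  2 * size X + m * n          ≤⟨ +-monoʳ-≤ (2 * size X) (outside-≥-half-dense G dense 2deg≤ X indep) ⟩
  2 * size X + 2 * outside X  ≡⟨ *-distribˡ-+ 2 (size X) (outside X) ⟨
  2 * (size X + outside X)    ≡⟨ cong (2 *_) (size+outside X) ⟩
  2 * (suc m * n)             ≡⟨ solve 2 (λ m n → con 2 :* ((con 1 :+ m) :* n)
                                                 := (con 2 :+ m) :* n :+ m :* n) refl m n ⟩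
  suc (suc m) * n + m * n     ∎)
  where
  open ≤-Reasoning
  2deg≤ : ∀ v → 2 * degree G v ≤ suc m * n
  2deg≤ (k , a) rewrite degree≡neighbours-outside-part G part k a =
    independent-set-bound m (restrict (punchIn k) G)
      (restrict-partite (punchIn k) G part)
      (restrict-half-dense (punchIn k) G (punchIn-injective k _ _) dense)
      (restrict-triangle-free (punchIn k) G tri)
      (adj G (k , a) ∘ map₁ (punchIn k))
      (restrict-independent (punchIn k) G (neighbourhood-independent G tri (k , a)))

corollary9 : (ℓ n : ℕ) → 1 ≤ n → (G : SimpleGraph (Vtx ℓ n)) →
    IsPartite G →
    (∀ (i j : Fin ℓ) → i ≢ j → n * n ≤ 2 * edgesInduced G i j) →
    TriangleFree G →
    (X : Vtx ℓ n → Bool) → Independent G X →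
    2 * card X ≤ (ℓ + 1) * n
corollary9 ℓ n 1≤n G part dense tri X indep =
  subst₂ (λ c k → 2 * c ≤ k * n) (sym (card≡size X)) (+-comm 1 ℓ)
    (independent-set-bound ℓ {{>-nonZero 1≤n}} G part half-dense tri X indep)
  where
  half-dense : HalfDense G
  half-dense i j i≢j = subst (λ e → n * n ≤ 2 * e) (edgesInduced-partite G part i j) (dense i j i≢j)
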